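{- Let $M$ be a boolean $n\times n$ matrix with rows and columns indexed by $[n]=\{0,\dots,n-1\}$. Let $(u^0,v^0),\dots,(u^{n-1},v^{n-1})$ be pairs of boolean vectors in $\{0,1\}^n$. Construct a graph on node sets $S,A,B,C,D,T$. For $X\in\{S,A,B,C,D,T\}$ with lowercase letter $x$, the set $X$ consists of $2n$ nodes $x^\ell_0,x^r_0,\dots,x^\ell_{n-1},x^r_{n-1}$. Initially the graph has these edges: - $(a^\ell_i,a^r_i)$, $(b^\ell_i,b^r_i)$, $(c^\ell_i,c^r_i)$, $(d^\ell_i,d^r_i)$ for all $i\in[n]$; - $(b^r_i,c^\ell_j)$ for all $i,j$ with $M_{ij}=1$. Then perform phases $i=0,1,\dots,n-1$. Phase $i$ consists of: 1. add $(a^r_i,b^\ell_j)$ for every $j$ with $u^i_j=1$; 2. add $(c^r_j,d^\ell_i)$ for every $j$ with $v^i_j=1$; 3. add $(s^r_i,a^\ell_i)$ and $(d^r_i,t^\ell_i)$; 4. query the size of a maximum matching; 5. add $(s^\ell_i,s^r_i)$ and $(t^\ell_i,t^r_i)$. Then for every $i\in[n]$, the maximum matching size reported by the query in phase $i$ equals $4n+2i+1$ if $(u^i)^TMv^i=1$, and equals $4n+2i$ otherwise.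
   Context: $(u^i)^TMv^i$ is the Boolean vector-matrix-vector product. It equals $1$ iff there exist $j,k$ with $u^i_j=M_{jk}=v^i_k=1$. -}

module Defs where

open import Data.Nat using (ℕ)
open import Data.Bool using (Bool; true)
open import Data.Fin using (Fin; _<_)
open import Data.Product using (Σ; _×_; _,_; ∃)
open import Data.Sum using (_⊎_)
open import Data.List using (List; []; _∷_; length; concatMap)
open import Data.List.Relation.Unary.All using (All)
open import Data.List.Relation.Unary.Unique.Propositional using (Unique)
open import Relation.Binary.PropositionalEquality using (_≡_)
open import Data.Nat using (_≤_)

BVec : ℕ → Set
BVec n = Fin n → Bool

BMat : ℕ → Set
BMat n = Fin n → Fin n → Bool

-- (u^T M v) = 1  iff  ∃ j k. u_j = M_jk = v_k = 1
VMV-one : ∀ {n} → BVec n → BMat n → BVec n → Set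
VMV-one u M v = Σ _ λ j → Σ _ λ k → (u j ≡ true) × (M j k ≡ true) × (v k ≡ true)

data Letter : Set where
  S A B C D T : Letter

data Side : Set where
  ℓ r : Side

record Node (n : ℕ) : Set where
  constructor node
  field
    letter : Letter
    side   : Side
    index  : Fin n

EdgeSet : ℕ → Set₁
EdgeSet n = Node n → Node n → Set

Adj : ∀ {n} → EdgeSet n → Node n → Node n → Set
Adj E x y = E x y ⊎ E y x

endpoints : ∀ {n} → List (Node n × Node n) → List (Node n)
endpoints = concatMap (λ { (x , y) → x ∷ y ∷ [] })

IsMatching : ∀ {n} → EdgeSet n → List (Node n × Node n) → Set
IsMatching E m = All (λ { (x , y) → Adj E x y }) m × Unique (endpoints m)

MaxMatchingSize : ∀ {n} → EdgeSet n → ℕ → Set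
MaxMatchingSize E k =
  (Σ _ λ m → IsMatching E m × length m ≡ k) ×
  (∀ m → IsMatching E m → length m ≤ k)

module Construction {n : ℕ} (M : BMat n) (u v : Fin n → BVec n) where

  data Initial : EdgeSet n where
    aa : ∀ i → Initial (node A ℓ i) (node A r i)
    bb : ∀ i → Initial (node B ℓ i) (node B r i)
    cc : ∀ i → Initial (node C ℓ i) (node C r i)
    dd : ∀ i → Initial (node D ℓ i) (node D r i)
    bc : ∀ i j → M i j ≡ true → Initial (node B r i) (node C ℓ j)

  data Steps123 (i : Fin n) : EdgeSet n where
    ab : ∀ j → u i j ≡ true → Steps123 i (node A r i) (node B ℓ j)
    cd : ∀ j → v i j ≡ true → Steps123 i (node C r j) (node D ℓ i)
    sa : Steps123 i (node S r i) (node A ℓ i)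
    dt : Steps123 i (node D r i) (node T ℓ i)

  data Step5 (i : Fin n) : EdgeSet n where
    ss : Step5 i (node S ℓ i) (node S r i)
    tt : Step5 i (node T ℓ i) (node T r i)

  QueryGraph : Fin n → EdgeSet n
  QueryGraph i x y =
    Initial x y
    ⊎ (Σ (Fin n) λ p → p < i × (Steps123 p x y ⊎ Step5 p x y))
    ⊎ Steps123 i x y

module Submission where

-- The query graph of phase i always contains the rungs x^ℓ_q x^r_q of the letters A, B, C, D and,
-- for the earlier phases p < i, of S and T: a matching of size 4n + 2i. If u_j = M_jk = v_k = 1, the
-- path s^r_i a^ℓ_i a^r_i b^ℓ_j b^r_j c^ℓ_k c^r_k d^ℓ_i d^r_i t^ℓ_i augments it; the augmented matching
-- pairs each ℓ-node of the path with the r-node of the preceding letter in the cycle S A B C D T.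
-- Optimality is certified by vertex covers of the same sizes, consisting of one end of every rung
-- (plus s^r_i in the first case). When (u^i)^T M v^i = 0 the cover contains b^ℓ_q for q in the
-- support of u^i and c^ℓ_q for q in the support of (u^i)^T M; every edge c^r_k d^ℓ_i has v_k = 1,
-- so k lies outside that support and c^r_k is in the cover.

open import Defs
open import Data.Nat using (ℕ; suc; _+_; _*_; _≤_; z≤n; s≤s)
import Data.Nat as ℕ
open import Data.Nat.Properties using (+-comm; module ≤-Reasoning)
open import Data.Fin using (Fin; toℕ; _≟_; _<_; inject≤; fromℕ<)
open import Data.Fin.Properties
  using (any?; toℕ-injective; toℕ-inject≤; toℕ-fromℕ<; toℕ<n; toℕ≤n; inject≤-injective;
         <⇒≢; <-irrefl)
open import Data.Bool using (true; false; if_then_else_)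
open import Data.Bool.Properties using () renaming (_≟_ to _≟ᵇ_)
open import Data.Product using (Σ; _×_; _,_; proj₁; proj₂; <_,_>)
open import Data.Sum using (_⊎_; inj₁; inj₂; swap) renaming (map to ⊎-map)
open import Data.Empty using (⊥-elim)
open import Data.Unit using (⊤)
open import Data.List using (List; []; _∷_; _++_; map; length; tabulate; allFin; cartesianProduct)
open import Data.List.Properties using (length-++; length-map; length-tabulate)
open import Data.List.Relation.Unary.All as All using (All; []; _∷_)
open import Data.List.Relation.Unary.All.Properties using (¬Any⇒All¬) renaming (map⁺ to All-map⁺)
open import Data.List.Relation.Unary.AllPairs using ([]; _∷_)
open import Data.List.Relation.Unary.Any using (here; there)
open import Data.List.Relation.Unary.Unique.Propositional using (Unique)
open import Data.List.Relation.Unary.Unique.Propositional.Properties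
  using (++⁺; cartesianProduct⁺; allFin⁺; tabulate⁺)
open import Data.List.Membership.Propositional using (_∈_; _∉_)
open import Data.List.Membership.Propositional.Properties
  using (∈-++⁺ˡ; ∈-++⁺ʳ; ∈-++⁻; ∈-∃++; ∈-allFin; ∈-tabulate⁺; ∈-tabulate⁻; ∈-map⁺;
         ∈-cartesianProduct⁺; ∈-cartesianProduct⁻)
open import Relation.Binary.PropositionalEquality
open import Relation.Nullary using (¬_; Dec; yes; no; does)
open import Relation.Nullary.Decidable using (dec-true; dec-false; _×-dec_)
open import Function using (_∘_; id)
open import Function.Definitions using (Injective)

length-cartesianProduct : ∀ {X Y : Set} (xs : List X) (ys : List Y) →
  length (cartesianProduct xs ys) ≡ length xs * length ys
length-cartesianProduct [] ys = refl
length-cartesianProduct (x ∷ xs) ys = begin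
  length (map (x ,_) ys ++ cartesianProduct xs ys)
    ≡⟨ length-++ (map (x ,_) ys) ⟩
  length (map (x ,_) ys) + length (cartesianProduct xs ys)
    ≡⟨ cong₂ _+_ (length-map (x ,_) ys) (length-cartesianProduct xs ys) ⟩
  length ys + length xs * length ys ∎
  where open ≡-Reasoning

length-++-∷ : ∀ {X : Set} (xs : List X) {w ys} → length (xs ++ w ∷ ys) ≡ suc (length (xs ++ ys))
length-++-∷ [] = refl
length-++-∷ (x ∷ xs) = cong suc (length-++-∷ xs)

∈-++-∷⁻ : ∀ {X : Set} (xs : List X) {v w ys} → v ∈ xs ++ w ∷ ys → w ≢ v → v ∈ xs ++ ys
∈-++-∷⁻ [] (here refl) w≢v = ⊥-elim (w≢v refl)
∈-++-∷⁻ [] (there v∈ys) _ = v∈ys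
∈-++-∷⁻ (x ∷ xs) (here refl) _ = here refl
∈-++-∷⁻ (x ∷ xs) (there v∈) w≢v = there (∈-++-∷⁻ xs v∈ w≢v)

finsBelow : ∀ {n} → Fin n → List (Fin n)
finsBelow i = tabulate λ p → inject≤ p (toℕ≤n i)

length-finsBelow : ∀ {n} (i : Fin n) → length (finsBelow i) ≡ toℕ i
length-finsBelow i = length-tabulate _

finsBelow-unique : ∀ {n} (i : Fin n) → Unique (finsBelow i)
finsBelow-unique i = tabulate⁺ (inject≤-injective _ _ _ _)

∈-finsBelow⁺ : ∀ {n} {p i : Fin n} → p < i → p ∈ finsBelow i
∈-finsBelow⁺ {i = i} p<i =
  subst (_∈ finsBelow i) (toℕ-injective (trans (toℕ-inject≤ _ _) (toℕ-fromℕ< p<i)))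
    (∈-tabulate⁺ (fromℕ< p<i))

∈-finsBelow⁻ : ∀ {n} {p i : Fin n} → p ∈ finsBelow i → p < i
∈-finsBelow⁻ {i = i} p∈ with ∈-tabulate⁻ p∈
... | p′ , refl = subst (ℕ._< toℕ i) (sym (toℕ-inject≤ p′ _)) (toℕ<n p′)

module _ {n : ℕ} where

  Covers : List (Node n) → Node n × Node n → Set
  Covers K (x , y) = x ∈ K ⊎ y ∈ K

  shrink-cover : ∀ xs {w ys} m → All (w ≢_) (endpoints m) →
    All (Covers (xs ++ w ∷ ys)) m → All (Covers (xs ++ ys)) m
  shrink-cover xs [] _ [] = []
  shrink-cover xs ((a , b) ∷ m) (w≢a ∷ w≢b ∷ w∉m) (ab-covered ∷ m-covered) =
    ⊎-map (λ a∈ → ∈-++-∷⁻ xs a∈ w≢a) (λ b∈ → ∈-++-∷⁻ xs b∈ w≢b) ab-covered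
      ∷ shrink-cover xs m w∉m m-covered

  covered-length≤ : ∀ {K} m → All (Covers K) m → Unique (endpoints m) → length m ≤ length K

  covered-length< : ∀ {w K m} → w ∈ K → All (w ≢_) (endpoints m) → All (Covers K) m →
    Unique (endpoints m) → length m ℕ.< length K

  covered-length≤ [] _ _ = z≤n
  covered-length≤ ((x , y) ∷ m) (inj₁ x∈K ∷ m-covered) ((_ ∷ x∉m) ∷ _ ∷ m!) =
    covered-length< x∈K x∉m m-covered m!
  covered-length≤ ((x , y) ∷ m) (inj₂ y∈K ∷ m-covered) (_ ∷ y∉m ∷ m!) =
    covered-length< y∈K y∉m m-covered m!

  covered-length< {w} {m = m} w∈K w∉m m-covered m! with ∈-∃++ w∈K
  ... | xs , ys , refl = begin
    suc (length m)            ≤⟨ s≤s (covered-length≤ m (shrink-cover xs m w∉m m-covered) m!) ⟩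
    suc (length (xs ++ ys))   ≡⟨ length-++-∷ xs ⟨
    length (xs ++ w ∷ ys)     ∎
    where open ≤-Reasoning

  matching-length≤cover : ∀ {E : EdgeSet n} {K m} → (∀ {x y} → E x y → Covers K (x , y)) →
    IsMatching E m → length m ≤ length K
  matching-length≤cover {m = m} covers (m-edges , m!) =
    covered-length≤ m (All.map (λ { (inj₁ e) → covers e ; (inj₂ e) → swap (covers e) }) m-edges) m!

  matching+cover⇒MaxMatchingSize : ∀ {E : EdgeSet n} {K m k} →
    IsMatching E m → length m ≡ k → (∀ {x y} → E x y → Covers K (x , y)) → length K ≡ k →
    MaxMatchingSize E k
  matching+cover⇒MaxMatchingSize {m = m} m-matching |m| covers |K| =
    (m , m-matching , |m|) ,
    λ m′ m′-matching → subst (length m′ ≤_) |K| (matching-length≤cover covers m′-matching)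

  module _ {X : Set} {f g : X → Node n} (f-inj : Injective _≡_ _≡_ f) (g-inj : Injective _≡_ _≡_ g)
           (f≢g : ∀ x y → f x ≢ g y) where

    endpoints-map-unique : ∀ {xs} → Unique xs → Unique (endpoints (map < f , g > xs))
    endpoints-map-unique {[]} [] = []
    endpoints-map-unique {x ∷ xs} (x∉xs ∷ xs!) =
      (f≢g x x ∷ f-fresh x∉xs) ∷ g-fresh x∉xs ∷ endpoints-map-unique xs!
      where
      f-fresh : ∀ {ys} → All (x ≢_) ys → All (f x ≢_) (endpoints (map < f , g > ys))
      f-fresh [] = []
      f-fresh {y ∷ _} (x≢y ∷ x∉ys) = (x≢y ∘ f-inj) ∷ f≢g x y ∷ f-fresh x∉ys
      g-fresh : ∀ {ys} → All (x ≢_) ys → All (g x ≢_) (endpoints (map < f , g > ys))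
      g-fresh [] = []
      g-fresh {y ∷ _} (x≢y ∷ x∉ys) = (f≢g y x ∘ sym) ∷ (x≢y ∘ g-inj) ∷ g-fresh x∉ys

  nodeAt : Side → Letter × Fin n → Node n
  nodeAt s (L , q) = node L s q

  nodeAt-injective : ∀ s → Injective _≡_ _≡_ (nodeAt s)
  nodeAt-injective s {_ , _} {_ , _} refl = refl

  rungsVia : (Letter × Fin n → Letter × Fin n) → List (Letter × Fin n) → List (Node n × Node n)
  rungsVia π = map < nodeAt r ∘ π , nodeAt ℓ >

  length-rungsVia : ∀ π ss → length (rungsVia π ss) ≡ length ss
  length-rungsVia π = length-map _

  rungsVia-isMatching : ∀ {E : EdgeSet n} {π ss} → Injective _≡_ _≡_ π → Unique ss →
    (∀ {s} → s ∈ ss → Adj E (nodeAt r (π s)) (nodeAt ℓ s)) → IsMatching E (rungsVia π ss)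
  rungsVia-isMatching π-inj ss! edge =
    All-map⁺ (All.tabulate edge) ,
    endpoints-map-unique (π-inj ∘ nodeAt-injective r) (nodeAt-injective ℓ)
      (λ { (_ , _) (_ , _) () }) ss!

  coverVia : (Letter × Fin n → Side) → List (Letter × Fin n) → List (Node n)
  coverVia σ = map λ s → nodeAt (σ s) s

  length-coverVia : ∀ σ ss → length (coverVia σ ss) ≡ length ss
  length-coverVia σ = length-map _

  ∈-coverVia : ∀ {σ ss L q s} → (L , q) ∈ ss → σ (L , q) ≡ s → node L s q ∈ coverVia σ ss
  ∈-coverVia {σ} L,q∈ss refl = ∈-map⁺ (λ s → nodeAt (σ s) s) L,q∈ss

  rung-covered : ∀ {σ ss L q} → (L , q) ∈ ss → Covers (coverVia σ ss) (node L ℓ q , node L r q)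
  rung-covered {σ} {L = L} {q} L,q∈ss with σ (L , q) in σ≡
  ... | ℓ = inj₁ (∈-coverVia L,q∈ss σ≡)
  ... | r = inj₂ (∈-coverVia L,q∈ss σ≡)

module CyclicShift {X : Set} {n : ℕ} (prev next : X → X) (next∘prev : ∀ x → next (prev x) ≡ x)
                   (idx : X → Fin n) where

  shift : X × Fin n → X × Fin n
  shift (x , q) with q ≟ idx x
  ... | yes _ = prev x , idx (prev x)
  ... | no _ = x , q

  shift-injective : Injective _≡_ _≡_ shift
  shift-injective {s} {s′} eq =
    trans (sym (unshift∘shift s)) (trans (cong unshift eq) (unshift∘shift s′))
    where
    unshift : X × Fin n → X × Fin n
    unshift (x , q) with q ≟ idx x
    ... | yes _ = next x , idx (next x)
    ... | no _ = x , q

    unshift∘shift : ∀ s → unshift (shift s) ≡ s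
    unshift∘shift (x , q) with q ≟ idx x
    unshift∘shift (x , q) | yes refl with idx (prev x) ≟ idx (prev x)
    ... | yes _ = cong (λ y → y , idx y) (next∘prev x)
    ... | no ≢ = ⊥-elim (≢ refl)
    unshift∘shift (x , q) | no q≢ with q ≟ idx x
    ... | yes q≡ = ⊥-elim (q≢ q≡)
    ... | no _ = refl

prevLetter nextLetter : Letter → Letter
prevLetter S = T
prevLetter A = S
prevLetter B = A
prevLetter C = B
prevLetter D = C
prevLetter T = D
nextLetter S = A
nextLetter A = B
nextLetter B = C
nextLetter C = D
nextLetter D = T
nextLetter T = S

next∘prevLetter : ∀ L → nextLetter (prevLetter L) ≡ L
next∘prevLetter S = refl
next∘prevLetter A = refl
next∘prevLetter B = refl
next∘prevLetter C = refl
next∘prevLetter D = refl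
next∘prevLetter T = refl

fixedLetters phaseLetters : List Letter
fixedLetters = A ∷ B ∷ C ∷ D ∷ []
phaseLetters = S ∷ T ∷ []

phase∉fixed : ∀ {L} → L ∈ phaseLetters → L ∉ fixedLetters
phase∉fixed (here refl) (there (there (there (there ()))))
phase∉fixed (there (here refl)) (there (there (there (there ()))))

module Slots {n : ℕ} (i : Fin n) where

  -- The slot (L , q) stands for the rung x^ℓ_q x^r_q of the letter L.
  Active : Letter × Fin n → Set
  Active (S , q) = q < i
  Active (T , q) = q < i
  Active (_ , _) = ⊤

  fixedSlots phaseSlots slots : List (Letter × Fin n)
  fixedSlots = cartesianProduct fixedLetters (allFin n)
  phaseSlots = cartesianProduct phaseLetters (finsBelow i)
  slots = fixedSlots ++ phaseSlots

  ∈-fixedSlots⁺ : ∀ {L q} → L ∈ fixedLetters → (L , q) ∈ slots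
  ∈-fixedSlots⁺ {q = q} L∈ = ∈-++⁺ˡ (∈-cartesianProduct⁺ {xs = fixedLetters} L∈ (∈-allFin q))

  ∈-phaseSlots⁺ : ∀ {L q} → L ∈ phaseLetters → q < i → (L , q) ∈ slots
  ∈-phaseSlots⁺ L∈ q<i =
    ∈-++⁺ʳ fixedSlots (∈-cartesianProduct⁺ {xs = phaseLetters} L∈ (∈-finsBelow⁺ q<i))

  ∈-slots⁺ : ∀ {s} → Active s → s ∈ slots
  ∈-slots⁺ {A , _} _ = ∈-fixedSlots⁺ (here refl)
  ∈-slots⁺ {B , _} _ = ∈-fixedSlots⁺ (there (here refl))
  ∈-slots⁺ {C , _} _ = ∈-fixedSlots⁺ (there (there (here refl)))
  ∈-slots⁺ {D , _} _ = ∈-fixedSlots⁺ (there (there (there (here refl))))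
  ∈-slots⁺ {S , _} = ∈-phaseSlots⁺ (here refl)
  ∈-slots⁺ {T , _} = ∈-phaseSlots⁺ (there (here refl))

  ∈-fixedSlots⁻ : ∀ {L q} → (L , q) ∈ fixedSlots → L ∈ fixedLetters
  ∈-fixedSlots⁻ = proj₁ ∘ ∈-cartesianProduct⁻ fixedLetters (allFin n)

  ∈-phaseSlots⁻ : ∀ {L q} → (L , q) ∈ phaseSlots → L ∈ phaseLetters × q < i
  ∈-phaseSlots⁻ s∈ =
    let L∈ , q∈ = ∈-cartesianProduct⁻ phaseLetters (finsBelow i) s∈ in L∈ , ∈-finsBelow⁻ q∈

  phase-slot : ∀ {L q} → L ∈ phaseLetters → (L , q) ∈ slots → q < i
  phase-slot L∈phase s∈ with ∈-++⁻ fixedSlots s∈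
  ... | inj₁ s∈fixed = ⊥-elim (phase∉fixed L∈phase (∈-fixedSlots⁻ s∈fixed))
  ... | inj₂ s∈phase = proj₂ (∈-phaseSlots⁻ s∈phase)

  ∈-slots⁻ : ∀ {s} → s ∈ slots → Active s
  ∈-slots⁻ {A , _} _ = _
  ∈-slots⁻ {B , _} _ = _
  ∈-slots⁻ {C , _} _ = _
  ∈-slots⁻ {D , _} _ = _
  ∈-slots⁻ {S , _} = phase-slot (here refl)
  ∈-slots⁻ {T , _} = phase-slot (there (here refl))

  slots-unique : Unique slots
  slots-unique =
    ++⁺ (cartesianProduct⁺ fixed! (allFin⁺ n)) (cartesianProduct⁺ phase! (finsBelow-unique i))
    λ (s∈fixed , s∈phase) → phase∉fixed (proj₁ (∈-phaseSlots⁻ s∈phase)) (∈-fixedSlots⁻ s∈fixed)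
    where
    fixed! : Unique fixedLetters
    fixed! = ((λ ()) ∷ (λ ()) ∷ (λ ()) ∷ []) ∷ ((λ ()) ∷ (λ ()) ∷ []) ∷ ((λ ()) ∷ []) ∷ [] ∷ []
    phase! : Unique phaseLetters
    phase! = ((λ ()) ∷ []) ∷ [] ∷ []

  Tᵢ∉slots : (T , i) ∉ slots
  Tᵢ∉slots = <-irrefl refl ∘ ∈-slots⁻

  length-slots : length slots ≡ 4 * n + 2 * toℕ i
  length-slots = begin
    length (fixedSlots ++ phaseSlots)
      ≡⟨ length-++ fixedSlots ⟩
    length fixedSlots + length phaseSlots
      ≡⟨ cong₂ _+_ (length-cartesianProduct fixedLetters (allFin n))
                   (length-cartesianProduct phaseLetters (finsBelow i)) ⟩
    4 * length (allFin n) + 2 * length (finsBelow i)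
      ≡⟨ cong₂ (λ a b → 4 * a + 2 * b) (length-tabulate {n = n} id) (length-finsBelow i) ⟩
    4 * n + 2 * toℕ i ∎
    where open ≡-Reasoning

  length-∷-slots : ∀ s → length (s ∷ slots) ≡ 4 * n + 2 * toℕ i + 1
  length-∷-slots _ = trans (cong suc length-slots) (+-comm 1 _)

pattern initial e = inj₁ e
pattern earlier123 p p<i e = inj₂ (inj₁ (p , p<i , inj₁ e))
pattern earlier5 p p<i e = inj₂ (inj₁ (p , p<i , inj₂ e))
pattern current e = inj₂ (inj₂ e)

module Phase {n : ℕ} (M : BMat n) (u v : Fin n → BVec n) (i : Fin n) where
  open Construction M u v
  open Slots i

  Q : EdgeSet n
  Q = QueryGraph i

  rung-edge : ∀ {s} → Active s → Adj Q (nodeAt r s) (nodeAt ℓ s)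
  rung-edge {A , q} _ = inj₂ (initial (aa q))
  rung-edge {B , q} _ = inj₂ (initial (bb q))
  rung-edge {C , q} _ = inj₂ (initial (cc q))
  rung-edge {D , q} _ = inj₂ (initial (dd q))
  rung-edge {S , p} p<i = inj₂ (earlier5 p p<i ss)
  rung-edge {T , p} p<i = inj₂ (earlier5 p p<i tt)

  rungs-matching : IsMatching Q (rungsVia id slots)
  rungs-matching = rungsVia-isMatching id slots-unique (rung-edge ∘ ∈-slots⁻)

  length-rungs : length (rungsVia id slots) ≡ 4 * n + 2 * toℕ i
  length-rungs = trans (length-rungsVia id slots) length-slots

  at-i : does (i ≟ i) ≡ true
  at-i = dec-true (i ≟ i) refl

  before-i : ∀ {p} → p < i → does (p ≟ i) ≡ false
  before-i p<i = dec-false (_ ≟ i) (<⇒≢ p<i)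

  σ₁ : Letter × Fin n → Side
  σ₁ (D , q) = if does (q ≟ i) then r else ℓ
  σ₁ (T , _) = ℓ
  σ₁ (_ , _) = r

  cover₁ : List (Node n)
  cover₁ = coverVia σ₁ ((S , i) ∷ slots)

  ∈-cover₁ : ∀ {L q s} → Active (L , q) → σ₁ (L , q) ≡ s → node L s q ∈ cover₁
  ∈-cover₁ = ∈-coverVia ∘ there ∘ ∈-slots⁺

  length-cover₁ : length cover₁ ≡ 4 * n + 2 * toℕ i + 1
  length-cover₁ = trans (length-coverVia σ₁ ((S , i) ∷ slots)) (length-∷-slots (S , i))

  cover₁-covers : ∀ {x y} → Q x y → Covers cover₁ (x , y)
  cover₁-covers (initial (aa q)) = rung-covered (there (∈-slots⁺ _))
  cover₁-covers (initial (bb q)) = rung-covered (there (∈-slots⁺ _))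
  cover₁-covers (initial (cc q)) = rung-covered (there (∈-slots⁺ _))
  cover₁-covers (initial (dd q)) = rung-covered (there (∈-slots⁺ _))
  cover₁-covers (initial (bc j k _)) = inj₁ (∈-cover₁ _ refl)
  cover₁-covers (earlier123 p p<i (ab j _)) = inj₁ (∈-cover₁ _ refl)
  cover₁-covers (earlier123 p p<i (cd j _)) = inj₁ (∈-cover₁ _ refl)
  cover₁-covers (earlier123 p p<i sa) = inj₁ (∈-cover₁ p<i refl)
  cover₁-covers (earlier123 p p<i dt) = inj₂ (∈-cover₁ p<i refl)
  cover₁-covers (earlier5 p p<i ss) = rung-covered (there (∈-slots⁺ p<i))
  cover₁-covers (earlier5 p p<i tt) = rung-covered (there (∈-slots⁺ p<i))
  cover₁-covers (current (ab j _)) = inj₁ (∈-cover₁ _ refl)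
  cover₁-covers (current (cd j _)) = inj₁ (∈-cover₁ _ refl)
  cover₁-covers (current sa) = inj₁ (here refl)
  cover₁-covers (current dt) = inj₁ (∈-cover₁ _ (cong (if_then r else ℓ) at-i))
  Reachable : Fin n → Set
  Reachable k = Σ (Fin n) λ j → u i j ≡ true × M j k ≡ true

  reachable? : ∀ k → Dec (Reachable k)
  reachable? k = any? λ j → (u i j ≟ᵇ true) ×-dec (M j k ≟ᵇ true)

  σ₀ : Letter × Fin n → Side
  σ₀ (A , q) = if does (q ≟ i) then ℓ else r
  σ₀ (B , q) = if u i q then ℓ else r
  σ₀ (C , q) = if does (reachable? q) then ℓ else r
  σ₀ (D , q) = if does (q ≟ i) then r else ℓ
  σ₀ (S , _) = r
  σ₀ (T , _) = ℓ

  cover₀ : List (Node n)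
  cover₀ = coverVia σ₀ slots

  ∈-cover₀ : ∀ {L q s} → Active (L , q) → σ₀ (L , q) ≡ s → node L s q ∈ cover₀
  ∈-cover₀ = ∈-coverVia ∘ ∈-slots⁺

  length-cover₀ : length cover₀ ≡ 4 * n + 2 * toℕ i
  length-cover₀ = trans (length-coverVia σ₀ slots) length-slots

  cover₀-covers : ¬ VMV-one (u i) M (v i) → ∀ {x y} → Q x y → Covers cover₀ (x , y)
  cover₀-covers _ (initial (aa q)) = rung-covered (∈-slots⁺ _)
  cover₀-covers _ (initial (bb q)) = rung-covered (∈-slots⁺ _)
  cover₀-covers _ (initial (cc q)) = rung-covered (∈-slots⁺ _)
  cover₀-covers _ (initial (dd q)) = rung-covered (∈-slots⁺ _)
  cover₀-covers _ (initial (bc j k Mjk)) with u i j in uj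
  ... | true =
    inj₂ (∈-cover₀ _ (cong (if_then ℓ else r) (dec-true (reachable? k) (j , uj , Mjk))))
  ... | false = inj₁ (∈-cover₀ _ (cong (if_then ℓ else r) uj))
  cover₀-covers _ (earlier123 p p<i (ab j _)) =
    inj₁ (∈-cover₀ _ (cong (if_then ℓ else r) (before-i p<i)))
  cover₀-covers _ (earlier123 p p<i (cd j _)) =
    inj₂ (∈-cover₀ _ (cong (if_then r else ℓ) (before-i p<i)))
  cover₀-covers _ (earlier123 p p<i sa) = inj₁ (∈-cover₀ p<i refl)
  cover₀-covers _ (earlier123 p p<i dt) = inj₂ (∈-cover₀ p<i refl)
  cover₀-covers _ (earlier5 p p<i ss) = rung-covered (∈-slots⁺ p<i)
  cover₀-covers _ (earlier5 p p<i tt) = rung-covered (∈-slots⁺ p<i)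
  cover₀-covers _ (current (ab j uj)) = inj₂ (∈-cover₀ _ (cong (if_then ℓ else r) uj))
  cover₀-covers ¬uMv (current (cd k vk)) =
    inj₁ (∈-cover₀ _ (cong (if_then ℓ else r) (dec-false (reachable? k) unreachable)))
    where
    unreachable : ¬ Reachable k
    unreachable (j , uj , Mjk) = ¬uMv (j , k , uj , Mjk , vk)
  cover₀-covers _ (current sa) = inj₂ (∈-cover₀ _ (cong (if_then ℓ else r) at-i))
  cover₀-covers _ (current dt) = inj₁ (∈-cover₀ _ (cong (if_then r else ℓ) at-i))

  module Augmenting (j k : Fin n) (uj : u i j ≡ true) (Mjk : M j k ≡ true) (vk : v i k ≡ true) where

    pathIndex : Letter → Fin n
    pathIndex B = j
    pathIndex C = k
    pathIndex _ = i

    open CyclicShift prevLetter nextLetter next∘prevLetter pathIndex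

    path-edge : ∀ {L} → (L , pathIndex L) ∈ (T , i) ∷ slots →
      Adj Q (nodeAt r (prevLetter L , pathIndex (prevLetter L))) (nodeAt ℓ (L , pathIndex L))
    path-edge {S} (there Sᵢ∈slots) = ⊥-elim (<-irrefl refl (∈-slots⁻ Sᵢ∈slots))
    path-edge {A} _ = inj₁ (current sa)
    path-edge {B} _ = inj₁ (current (ab j uj))
    path-edge {C} _ = inj₁ (initial (bc j k Mjk))
    path-edge {D} _ = inj₁ (current (cd k vk))
    path-edge {T} _ = inj₁ (current dt)

    augmented-edge : ∀ {s} → s ∈ (T , i) ∷ slots → Adj Q (nodeAt r (shift s)) (nodeAt ℓ s)
    augmented-edge {L , q} s∈ with q ≟ pathIndex L
    ... | yes refl = path-edge s∈
    augmented-edge {L , q} (here refl) | no q≢ = ⊥-elim (q≢ refl)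
    augmented-edge {L , q} (there s∈) | no _ = rung-edge (∈-slots⁻ s∈)

    -- The slot (T , i) carries the new edge d^r_i t^ℓ_i; the slot (S , i), which the shift sends to
    -- (T , i), is the one left out.
    augmented : List (Node n × Node n)
    augmented = rungsVia shift ((T , i) ∷ slots)

    length-augmented : length augmented ≡ 4 * n + 2 * toℕ i + 1
    length-augmented = trans (length-rungsVia shift ((T , i) ∷ slots)) (length-∷-slots (T , i))

    augmented-matching : IsMatching Q augmented
    augmented-matching =
      rungsVia-isMatching shift-injective (¬Any⇒All¬ slots Tᵢ∉slots ∷ slots-unique) augmented-edge

lemma1 : (n : ℕ) (M : BMat n) (u v : Fin n → BVec n) (i : Fin n) →
    (VMV-one (u i) M (v i) →
      MaxMatchingSize (Construction.QueryGraph M u v i) (4 * n + 2 * toℕ i + 1))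
    × (¬ VMV-one (u i) M (v i) →
      MaxMatchingSize (Construction.QueryGraph M u v i) (4 * n + 2 * toℕ i))
lemma1 n M u v i = augmenting-path , no-augmenting-path
  where
  open Phase M u v i

  augmenting-path : VMV-one (u i) M (v i) → MaxMatchingSize Q (4 * n + 2 * toℕ i + 1)
  augmenting-path (j , k , uj , Mjk , vk) =
    matching+cover⇒MaxMatchingSize augmented-matching length-augmented cover₁-covers length-cover₁
    where open Augmenting j k uj Mjk vk

  no-augmenting-path : ¬ VMV-one (u i) M (v i) → MaxMatchingSize Q (4 * n + 2 * toℕ i)
  no-augmenting-path ¬uMv =
    matching+cover⇒MaxMatchingSize rungs-matching length-rungs (cover₀-covers ¬uMv) length-cover₀
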